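{- Let $\mathcal{C}=(V,\mathcal{R})$ be a scheme, $X,Y\in\mathrm{Fib}(\mathcal{C})$, $S\in\mathcal{R}_{X,Y}$, and $L_S:=\{R\in\mathcal{R}_X: RS=\{S\}\}$. Then $d_{L_S}$ divides $\gcd(|X|,e_S)$.
   Context: A scheme is a pair $\mathcal{C}=(V,\mathcal{R})$, $V$ finite, $\mathcal{R}$ a partition of $V\times V$ into nonempty relations such that $\Delta_V$ is a union of members of $\mathcal{R}$, $\mathcal{R}$ is closed under transposition, and for $R,S,T\in\mathcal{R}$ the number $c_{RS}^T$ of $w$ with $(u,w)\in R,(w,v)\in S$ is the same for all $(u,v)\in T$. A fiber is a nonempty $X\subseteq V$ with $\Delta_X\in\mathcal{R}$; $\mathcal{R}_{X,Y}=\{R\in\mathcal{R}:R\subseteq X\times Y\}$, $\mathcal{R}_X=\mathcal{R}_{X,X}$. For $R\in\mathcal{R}_{X,Y}$, $d_R=|\{y:(x,y)\in R\}|$ (any $x\in X$) and $e_R=|\{x:(x,y)\in R\}|$ (any $y\in Y$); for a set $\mathcal{D}$ of basis relations $d_\mathcal{D}=\sum_{R\in\mathcal{D}}d_R$. The complex product is $RS=\{T\in\mathcal{R}:c_{RS}^T>0\}$. -}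

module Defs where

open import Data.Nat using (ℕ; zero; suc; _+_; _<_)
open import Data.Fin using (Fin; zero; suc; _≟_)
open import Data.Bool using (Bool; true; false; if_then_else_; _∧_)
open import Relation.Nullary.Decidable using (⌊_⌋)
open import Data.Product using (_×_; ∃₂)
open import Relation.Binary.PropositionalEquality using (_≡_)

count : ∀ {n} → (Fin n → Bool) → ℕ
count {zero}  p = 0
count {suc n} p = (if p zero then 1 else 0) + count (λ i → p (suc i))

sumOver : ∀ {n} → (Fin n → Bool) → (Fin n → ℕ) → ℕ
sumOver {zero}  p f = 0
sumOver {suc n} p f = (if p zero then f zero else 0) + sumOver (λ i → p (suc i)) (λ i → f (suc i))

cnum : ∀ {n r} → (Fin n → Fin n → Fin r) → Fin r → Fin r → Fin n → Fin n → ℕ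
cnum col R S u v = count (λ w → ⌊ col u w ≟ R ⌋ ∧ ⌊ col w v ≟ S ⌋)

-- A scheme on V = Fin n with r basis relations; the basis relation
-- containing (u,v) is col u v, the partition classes are the colour classes.
record Scheme (n r : ℕ) : Set where
  field
    col         : Fin n → Fin n → Fin r
    nonempty    : ∀ (i : Fin r) → ∃₂ λ u v → col u v ≡ i
    -- Δ_V is a union of basis relations
    diag        : ∀ (x u v : Fin n) → col u v ≡ col x x → u ≡ v
    transp      : Fin r → Fin r
    transp-spec : ∀ (u v : Fin n) → col v u ≡ transp (col u v)
    -- intersection numbers are well defined
    regular     : ∀ (R S T : Fin r) (u v u' v' : Fin n) → col u v ≡ T → col u' v' ≡ T →
                  cnum col R S u v ≡ cnum col R S u' v'

module _ {n r : ℕ} (C : Scheme n r) where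
  open Scheme C

  -- the basis relation X is Δ_X for a fiber X; X = {x | col x x ≡ X}
  IsFiber : Fin r → Set
  IsFiber X = ∀ (u v : Fin n) → col u v ≡ X → u ≡ v

  -- R ∈ 𝓡_{X,Y}, fibers given by their diagonal relations
  InRel : Fin r → Fin r → Fin r → Set
  InRel R X Y = ∀ (u v : Fin n) → col u v ≡ R → (col u u ≡ X) × (col v v ≡ Y)

  -- T ∈ RS, i.e. c_{RS}^T > 0 (evaluated at some (u,v) ∈ T)
  InProd : Fin r → Fin r → Fin r → Set
  InProd R S T = ∃₂ λ u v → (col u v ≡ T) × (0 < cnum col R S u v)

  ProdIsSingleton : Fin r → Fin r → Set
  ProdIsSingleton R S = ∀ (T : Fin r) → (InProd R S T → T ≡ S) × (T ≡ S → InProd R S T)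

  size : Fin r → ℕ
  size X = count (λ x → ⌊ col x x ≟ X ⌋)

  -- d_R computed at x (x ∈ X)
  dR : Fin r → Fin n → ℕ
  dR R x = count (λ y → ⌊ col x y ≟ R ⌋)

  -- e_R computed at y (y ∈ Y)
  eR : Fin r → Fin n → ℕ
  eR R y = count (λ x → ⌊ col x y ≟ R ⌋)

  -- d_𝓓 = Σ_{R ∈ 𝓓} d_R, computed at x
  dSet : (Fin r → Bool) → Fin n → ℕ
  dSet D x = sumOver D (λ R → dR R x)

module Submission where

-- Let S ∈ 𝓡_{X,Y} and write S(u) = {v : (u,v) ∈ S} for the S-neighbourhood
-- of u ∈ X.  The proof rests on one characterisation: for u, w ∈ X,
--
--     col u w ∈ L_S   iff   S(w) ⊆ S(u)   iff   S(w) = S(u),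
--
-- the second equivalence because all S-neighbourhoods of points of X have the
-- same size d_S.  Hence u ~ w :⇔ col u w ∈ L_S is an equivalence relation on
-- X (equality of S-neighbourhoods), and the ~-class of u has exactly
-- Σ_{R ∈ L_S} d_R = d_{L_S} elements.  Both X and the S-in-neighbourhood
-- {u : (u,y) ∈ S} of y ∈ Y are unions of ~-classes, so d_{L_S} divides |X| and
-- e_S, hence their gcd.

open import Defs
open import Data.Nat using (ℕ; zero; suc; _+_; _≤_; _<_; z≤n; s≤s)
open import Data.Nat.Properties
  using (≤-trans; ≤-reflexive; m≤n+m; +-assoc; +-comm; +-suc; <⇒≱; m<m+n)
open import Data.Nat.Induction using (<-wellFounded)
open import Induction.WellFounded using (Acc; acc)
open import Data.Nat.Divisibility using (_∣_; ∣-refl; ∣m∣n⇒∣m+n; _∣0)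
open import Data.Nat.GCD using (gcd; gcd-greatest)
open import Data.Fin using (Fin; zero; suc; _≟_)
open import Data.Bool using (Bool; true; false; if_then_else_; _∧_; not)
open import Data.Bool.Properties using (∧-zeroʳ; ∧-idem; ∧-conicalˡ; ∧-conicalʳ; not-¬)
open import Data.Product using (_×_; _,_; proj₁; proj₂; Σ)
open import Relation.Binary.PropositionalEquality
open import Relation.Nullary using (yes; no; ¬_)
open import Relation.Nullary.Decidable using (⌊_⌋)
open import Data.Empty using (⊥-elim)

≟-sound : ∀ {m} {a b : Fin m} → ⌊ a ≟ b ⌋ ≡ true → a ≡ b
≟-sound {a = a} {b} e with a ≟ b
... | yes a≡b = a≡b

≟-complete : ∀ {m} {a b : Fin m} → a ≡ b → ⌊ a ≟ b ⌋ ≡ true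
≟-complete {a = a} {b} a≡b with a ≟ b
... | yes _  = refl
... | no a≢b = ⊥-elim (a≢b a≡b)

≟-false : ∀ {m} {a b : Fin m} → ¬ (a ≡ b) → ⌊ a ≟ b ⌋ ≡ false
≟-false {a = a} {b} a≢b with a ≟ b
... | yes a≡b = ⊥-elim (a≢b a≡b)
... | no _    = refl

count-cong : ∀ {n} (p q : Fin n → Bool) → (∀ i → p i ≡ q i) → count p ≡ count q
count-cong {zero}  p q e = refl
count-cong {suc n} p q e rewrite e zero =
  cong (_ +_) (count-cong (λ i → p (suc i)) (λ i → q (suc i)) (λ i → e (suc i)))

count-pos : ∀ {n} (p : Fin n → Bool) (i : Fin n) → p i ≡ true → 0 < count p
count-pos p zero    pi rewrite pi = s≤s z≤n
count-pos p (suc i) pi = ≤-trans (count-pos (λ j → p (suc j)) i pi) (m≤n+m _ _)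

count-witness : ∀ {n} (p : Fin n → Bool) → 0 < count p → Σ (Fin n) λ i → p i ≡ true
count-witness {zero}  p ()
count-witness {suc n} p pos with p zero in p0
... | true  = zero , p0
... | false with count-witness (λ j → p (suc j)) pos
...   | i , pi = suc i , pi

count-split : ∀ {n} (p q : Fin n → Bool) →
              count p ≡ count (λ i → p i ∧ q i) + count (λ i → p i ∧ not (q i))
count-split {zero}  p q = refl
count-split {suc n} p q with p zero | q zero | count-split (λ i → p (suc i)) (λ i → q (suc i))
... | false | _     | ih = ih
... | true  | true  | ih = cong suc ih
... | true  | false | ih = trans (cong suc ih) (sym (+-suc _ _))

count-⊆-≤ : ∀ {n} (p q : Fin n → Bool) → (∀ i → p i ≡ true → q i ≡ true) →
            count q ≤ count p → ∀ i → q i ≡ true → p i ≡ true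
count-⊆-≤ p q p⊆q q≤p i qi with p i in pi
... | true  = refl
... | false = ⊥-elim (<⇒≱ (m<m+n (count p) rest-pos) (≤-trans (≤-reflexive (sym q≡p+rest)) q≤p))
  where
  q∧p≡p : ∀ j → q j ∧ p j ≡ p j
  q∧p≡p j with p j in pj
  ... | true  rewrite p⊆q j pj = refl
  ... | false = ∧-zeroʳ (q j)
  rest-pos : 0 < count (λ j → q j ∧ not (p j))
  rest-pos = count-pos _ i (cong₂ _∧_ qi (cong not pi))
  q≡p+rest : count q ≡ count p + count (λ j → q j ∧ not (p j))
  q≡p+rest = trans (count-split q p)
                   (cong (_+ count (λ j → q j ∧ not (p j))) (count-cong _ _ q∧p≡p))

sumOver-cong : ∀ {r} (D : Fin r → Bool) (f g : Fin r → ℕ) →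
               (∀ i → f i ≡ g i) → sumOver D f ≡ sumOver D g
sumOver-cong {zero}  D f g e = refl
sumOver-cong {suc r} D f g e rewrite e zero =
  cong (_ +_) (sumOver-cong (λ i → D (suc i)) (λ i → f (suc i)) (λ i → g (suc i)) (λ i → e (suc i)))

sumOver-zero : ∀ {r} (D : Fin r → Bool) → sumOver D (λ _ → 0) ≡ 0
sumOver-zero {zero}  D = refl
sumOver-zero {suc r} D with D zero
... | true  = sumOver-zero (λ i → D (suc i))
... | false = sumOver-zero (λ i → D (suc i))

sumOver-+ : ∀ {r} (D : Fin r → Bool) (f g : Fin r → ℕ) →
            sumOver D (λ i → f i + g i) ≡ sumOver D f + sumOver D g
sumOver-+ {zero}  D f g = refl
sumOver-+ {suc r} D f g with D zero | sumOver-+ (λ i → D (suc i)) (λ i → f (suc i)) (λ i → g (suc i))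
... | false | ih = ih
... | true  | ih = trans (cong (f zero + g zero +_) ih) (interchange (f zero) (g zero) _ _)
  where
  interchange : ∀ a b c d → a + b + (c + d) ≡ a + c + (b + d)
  interchange a b c d = begin
    a + b + (c + d)   ≡⟨ +-assoc a b (c + d) ⟩
    a + (b + (c + d)) ≡⟨ cong (a +_) (sym (+-assoc b c d)) ⟩
    a + (b + c + d)   ≡⟨ cong (λ t → a + (t + d)) (+-comm b c) ⟩
    a + (c + b + d)   ≡⟨ cong (a +_) (+-assoc c b d) ⟩
    a + (c + (b + d)) ≡⟨ sym (+-assoc a c (b + d)) ⟩
    a + c + (b + d)   ∎
    where open ≡-Reasoning

indicator : ∀ {r} → Fin r → Fin r → ℕ
indicator k R = if ⌊ k ≟ R ⌋ then 1 else 0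

sumOver-indicator : ∀ {r} (D : Fin r → Bool) (k : Fin r) →
                    sumOver D (indicator k) ≡ (if D k then 1 else 0)
sumOver-indicator {suc r} D zero with D zero
... | true  = cong suc (sumOver-zero (λ i → D (suc i)))
... | false = sumOver-zero (λ i → D (suc i))
sumOver-indicator {suc r} D (suc k) = trans (drop-head (D zero))
  (trans (sumOver-cong (λ i → D (suc i)) _ _ shift) (sumOver-indicator (λ i → D (suc i)) k))
  where
  drop-head : ∀ b {a} → (if b then 0 else 0) + a ≡ a
  drop-head true  = refl
  drop-head false = refl
  shift : ∀ i → indicator (suc k) (suc i) ≡ indicator k i
  shift i with k ≟ i
  ... | yes _ = refl
  ... | no _  = refl

sumOver-fibres : ∀ {n r} (D : Fin r → Bool) (f : Fin n → Fin r) →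
                 sumOver D (λ R → count (λ y → ⌊ f y ≟ R ⌋)) ≡ count (λ y → D (f y))
sumOver-fibres {zero}  D f = sumOver-zero D
sumOver-fibres {suc n} D f =
  trans (sumOver-+ D (indicator (f zero)) (λ R → count (λ y → ⌊ f (suc y) ≟ R ⌋)))
        (cong₂ _+_ (sumOver-indicator D (f zero)) (sumOver-fibres D (λ y → f (suc y))))

-- The relation E is only required to be symmetric and transitive; the union P
-- must lie in its domain, be closed under E, and consist of classes of size d.

module ClassUnion {n : ℕ} (E : Fin n → Fin n → Bool) (d : ℕ)
  (E-sym   : ∀ u w → E u w ≡ true → E w u ≡ true)
  (E-trans : ∀ u w z → E u w ≡ true → E w z ≡ true → E u z ≡ true) where

  record IsClassUnion (P : Fin n → Bool) : Set where
    field
      reflexive  : ∀ u → P u ≡ true → E u u ≡ true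
      class-size : ∀ u → P u ≡ true → count (E u) ≡ d
      closed     : ∀ u w → P u ≡ true → E u w ≡ true → P w ≡ true

  module RemoveClass (P : Fin n → Bool) (U : IsClassUnion P) (u : Fin n) (Pu : P u ≡ true) where
    open IsClassUnion U

    rest : Fin n → Bool
    rest w = P w ∧ not (E u w)

    size-rest : count P ≡ d + count rest
    size-rest = trans (count-split P (E u)) (cong (_+ count rest) class-in-P)
      where
      P∧E≡E : ∀ w → P w ∧ E u w ≡ E u w
      P∧E≡E w with E u w in Euw
      ... | true  rewrite closed u w Pu Euw = refl
      ... | false = ∧-zeroʳ (P w)
      class-in-P : count (λ w → P w ∧ E u w) ≡ d
      class-in-P = trans (count-cong _ _ P∧E≡E) (class-size u Pu)

    d-pos : 0 < d
    d-pos = subst (0 <_) (class-size u Pu) (count-pos (E u) u (reflexive u Pu))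

    rest-smaller : count rest < count P
    rest-smaller = subst (count rest <_) (trans (+-comm _ d) (sym size-rest)) (m<m+n (count rest) d-pos)

    rest-union : IsClassUnion rest
    rest-union = record
      { reflexive  = λ w h → reflexive w (∧-conicalˡ _ _ h)
      ; class-size = λ w h → class-size w (∧-conicalˡ _ _ h)
      ; closed     = rest-closed }
      where
      rest-closed : ∀ w z → rest w ≡ true → E w z ≡ true → rest z ≡ true
      rest-closed w z h Ewz with E u z in Euz
      ... | false = cong₂ _∧_ (closed w z (∧-conicalˡ _ _ h) Ewz) refl
      ... | true  = ⊥-elim (not-¬ (sym u~w) (sym (∧-conicalʳ (P w) _ h)))
        where
        -- u ~ z ~ w would put w into the removed class of u
        u~w : E u w ≡ true
        u~w = E-trans u z w Euz (E-sym w z Ewz)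

  union-divisible : (P : Fin n → Bool) → IsClassUnion P → d ∣ count P
  union-divisible P U = go P U (<-wellFounded (count P))
    where
    go : (P : Fin n → Bool) → IsClassUnion P → Acc _<_ (count P) → d ∣ count P
    go P U (acc smaller) with count P in size-P
    ... | zero  = d ∣0
    ... | suc _ with count-witness P (subst (0 <_) (sym size-P) (s≤s z≤n))
    ...   | u , Pu = subst (d ∣_) (trans (sym size-rest) size-P) (∣m∣n⇒∣m+n ∣-refl d∣rest)
      where
      open RemoveClass P U u Pu
      d∣rest : d ∣ count rest
      d∣rest = go rest rest-union (smaller (subst (count rest <_) size-P rest-smaller))

module SchemeFacts {n r : ℕ} (C : Scheme n r) where
  open Scheme C

  transp-involutive : ∀ R → transp (transp R) ≡ R
  transp-involutive R with nonempty R
  ... | a , b , refl = trans (cong transp (sym (transp-spec a b))) (sym (transp-spec b a))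

  ≟-transp : ∀ a b R → ⌊ col a b ≟ transp R ⌋ ≡ ⌊ col b a ≟ R ⌋
  ≟-transp a b R with col b a ≟ R
  ... | yes ba≡R = ≟-complete (trans (transp-spec b a) (cong transp ba≡R))
  ... | no ba≢R  = ≟-false λ ab≡R* →
    ba≢R (trans (transp-spec a b) (trans (cong transp ab≡R*) (transp-involutive R)))

  dR≡cnum : ∀ R u → dR C R u ≡ cnum col R (transp R) u u
  dR≡cnum R u = count-cong _ _ λ w →
    trans (sym (∧-idem ⌊ col u w ≟ R ⌋)) (cong (⌊ col u w ≟ R ⌋ ∧_) (sym (≟-transp w u R)))

  dR-uniform : ∀ R u v → col u u ≡ col v v → dR C R u ≡ dR C R v
  dR-uniform R u v e =
    trans (dR≡cnum R u) (trans (regular R (transp R) (col v v) u u v v e refl) (sym (dR≡cnum R v)))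

  -- Points related by the same basis relation lie in the same source fibre
  -- (c_{D R}^R > 0 for D = col u u, R = col u w, and D is diagonal) ...
  source-fibre : ∀ {u w u' w'} → col u' w' ≡ col u w → col u' u' ≡ col u u
  source-fibre {u} {w} {u'} {w'} e with count-witness _ pos
    where
    pos : 0 < cnum col (col u u) (col u w) u' w'
    pos = subst (0 <_) (regular (col u u) (col u w) (col u w) u w u' w' refl e)
                (count-pos (λ t → ⌊ col u t ≟ col u u ⌋ ∧ ⌊ col t w ≟ col u w ⌋) u
                           (cong₂ _∧_ (≟-complete {a = col u u} refl) (≟-complete {a = col u w} refl)))
  ... | z , hz = subst (λ t → col u' t ≡ col u u) (sym (diag u u' z u'z)) u'z
    where
    u'z : col u' z ≡ col u u
    u'z = ≟-sound (∧-conicalˡ _ _ hz)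

  target-fibre : ∀ {u w u' w'} → col u' w' ≡ col u w → col w' w' ≡ col w w
  target-fibre {u} {w} {u'} {w'} e =
    source-fibre (trans (transp-spec u' w') (trans (cong transp e) (sym (transp-spec u w))))

  module Neighbourhoods (S : Fin r) where

    out : Fin n → Fin n → Bool
    out u v = ⌊ col u v ≟ S ⌋

    Covers : Fin n → Fin n → Set
    Covers u w = ∀ v → col w v ≡ S → col u v ≡ S

    -- Neighbourhoods of points in one fibre have equal size, so inclusion is equality.
    covers-sym : ∀ {u w} → col u u ≡ col w w → Covers u w → Covers w u
    covers-sym {u} {w} e cov v uv = ≟-sound (count-⊆-≤ (out w) (out u) S[w]⊆S[u]
      (≤-reflexive (dR-uniform S u w e)) v (≟-complete uv))
      where
      S[w]⊆S[u] : ∀ v → out w v ≡ true → out u v ≡ true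
      S[w]⊆S[u] v h = ≟-complete (cov v (≟-sound h))

    common : Fin n → Fin n → Fin n → Bool
    common a b v = out a v ∧ out b v

    cnum≡common : ∀ a b → cnum col S (transp S) a b ≡ count (common a b)
    cnum≡common a b = count-cong _ _ λ v → cong (out a v ∧_) (≟-transp v b S)

    -- Whether S(w) ⊆ S(u) depends only on the basis relation containing (u,w):
    -- |S(u') ∩ S(w')| = |S(u) ∩ S(w)| = |S(w)| = |S(w')|.
    covers-invariant : ∀ {u w u' w'} → Covers u w → col u' w' ≡ col u w → Covers u' w'
    covers-invariant {u} {w} {u'} {w'} cov e v w'v =
      ≟-sound (∧-conicalˡ _ _ (count-⊆-≤ (common u' w') (out w') common⊆out
        (≤-reflexive out≡common) v (≟-complete w'v)))
      where
      common⊆out : ∀ v → common u' w' v ≡ true → out w' v ≡ true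
      common⊆out v h = ∧-conicalʳ (out u' v) _ h
      common≡out : ∀ v → common u w v ≡ out w v
      common≡out v with col w v ≟ S
      ... | yes wv = cong (_∧ true) (≟-complete (cov v wv))
      ... | no _   = ∧-zeroʳ (out u v)
      out≡common : count (out w') ≡ count (common u' w')
      out≡common = begin
        count (out w')                   ≡⟨ dR-uniform S w' w (target-fibre e) ⟩
        count (out w)                    ≡⟨ count-cong _ _ common≡out ⟨
        count (common u w)               ≡⟨ cnum≡common u w ⟨
        cnum col S (transp S) u w        ≡⟨ regular S (transp S) (col u w) u w u' w' refl e ⟩
        cnum col S (transp S) u' w'      ≡⟨ cnum≡common u' w' ⟩
        count (common u' w')             ∎
        where open ≡-Reasoning

module LeftStabiliser {n r : ℕ} (C : Scheme n r) (X Y S : Fin r) (S∈XY : InRel C S X Y)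
  (L : Fin r → Bool)
  (L-spec : ∀ (R : Fin r) → (L R ≡ true → InRel C R X X × ProdIsSingleton C R S)
                          × (InRel C R X X × ProdIsSingleton C R S → L R ≡ true)) where
  open Scheme C
  open SchemeFacts C
  open Neighbourhoods S

  out-nonempty : ∀ {w} → col w w ≡ X → Σ (Fin n) λ v → col w v ≡ S
  out-nonempty {w} wX with nonempty S
  ... | p , q , pq = proj₁ witness , ≟-sound (proj₂ witness)
    where
    -- |S(w)| = |S(p)| > 0, as p ∈ X
    size-pos : 0 < count (out w)
    size-pos = subst (0 <_) (dR-uniform S p w (trans (proj₁ (S∈XY p q pq)) (sym wX)))
                     (count-pos (out p) q (≟-complete pq))
    witness : Σ (Fin n) λ v → out w v ≡ true
    witness = count-witness (out w) size-pos

  L-sound : ∀ {u w} → L (col u w) ≡ true → col u u ≡ X × col w w ≡ X × Covers u w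
  L-sound {u} {w} h with proj₁ (L-spec (col u w)) h
  ... | inXX , RS≡S = proj₁ (inXX u w refl) , proj₂ (inXX u w refl) , covers
    where
    covers : Covers u w
    -- w witnesses col u v ∈ (col u w) S = {S}
    covers v wv = proj₁ (RS≡S (col u v))
      (u , v , refl , count-pos _ w (cong₂ _∧_ (≟-complete refl) (≟-complete wv)))

  L-complete : ∀ {u w} → col u u ≡ X → col w w ≡ X → Covers u w → L (col u w) ≡ true
  L-complete {u} {w} uX wX cov = proj₂ (L-spec (col u w)) (inXX , RS≡S)
    where
    inXX : InRel C (col u w) X X
    inXX u' w' e = trans (source-fibre e) uX , trans (target-fibre e) wX
    RS≡S : ProdIsSingleton C (col u w) S
    RS≡S T = RS⊆S , S∈RS
      where
      RS⊆S : InProd C (col u w) S T → T ≡ S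
      RS⊆S (u' , v' , u'v'T , pos)
        with count-witness (λ z → ⌊ col u' z ≟ col u w ⌋ ∧ out z v') pos
      ... | z , hz = trans (sym u'v'T)
        (covers-invariant cov (≟-sound (∧-conicalˡ _ _ hz)) v'
                          (≟-sound (∧-conicalʳ (⌊ col u' z ≟ col u w ⌋) _ hz)))
      S∈RS : T ≡ S → InProd C (col u w) S T
      S∈RS refl with out-nonempty wX
      ... | v , wv = u , v , cov v wv , count-pos _ w (cong₂ _∧_ (≟-complete refl) (≟-complete wv))

  E : Fin n → Fin n → Bool
  E u w = L (col u w)

  E-refl : ∀ {u} → col u u ≡ X → E u u ≡ true
  E-refl uX = L-complete uX uX λ v uv → uv

  E-sym : ∀ u w → E u w ≡ true → E w u ≡ true
  E-sym u w h with L-sound h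
  ... | uX , wX , cov = L-complete wX uX (covers-sym (trans uX (sym wX)) cov)

  E-trans : ∀ u w z → E u w ≡ true → E w z ≡ true → E u z ≡ true
  E-trans u w z h₁ h₂ with L-sound h₁ | L-sound h₂
  ... | uX , _ , cov₁ | _ , zX , cov₂ = L-complete uX zX λ v zv → cov₁ v (cov₂ v zv)

  E-class-size : ∀ {u x} → col u u ≡ X → col x x ≡ X → count (E u) ≡ dSet C L x
  E-class-size {u} {x} uX xX = trans (sym (sumOver-fibres L (col u)))
    (sumOver-cong L _ _ λ R → dR-uniform R u x (trans uX (sym xX)))

  module _ (x : Fin n) (xX : col x x ≡ X) where
    open ClassUnion E (dSet C L x) E-sym E-trans

    class-union-in-X : ∀ {P : Fin n → Bool} → (∀ u → P u ≡ true → col u u ≡ X) →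
           (∀ u w → P u ≡ true → E u w ≡ true → P w ≡ true) → IsClassUnion P
    class-union-in-X P⊆X closed = record
      { reflexive  = λ u Pu → E-refl (P⊆X u Pu)
      ; class-size = λ u Pu → E-class-size (P⊆X u Pu) xX
      ; closed     = closed }

    d∣size : dSet C L x ∣ size C X
    d∣size = union-divisible _ (class-union-in-X (λ u h → ≟-sound h)
      (λ u w _ Euw → ≟-complete (proj₁ (proj₂ (L-sound Euw)))))

    -- {u : (u,y) ∈ S} is a union of ~-classes, since ~ preserves S-neighbourhoods.
    d∣eR : ∀ y → dSet C L x ∣ eR C S y
    d∣eR y = union-divisible _ (class-union-in-X (λ u h → proj₁ (S∈XY u y (≟-sound h)))
      (λ u w uy Euw → ≟-complete (proj₂ (proj₂ (L-sound (E-sym u w Euw))) y (≟-sound uy))))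

lemma3 : ∀ {n r : ℕ} (C : Scheme n r) (X Y S : Fin r) →
         IsFiber C X → IsFiber C Y → InRel C S X Y →
         (L : Fin r → Bool) →
         (∀ (R : Fin r) → (L R ≡ true → InRel C R X X × ProdIsSingleton C R S)
                        × (InRel C R X X × ProdIsSingleton C R S → L R ≡ true)) →
         ∀ (x y : Fin n) → Scheme.col C x x ≡ X → Scheme.col C y y ≡ Y →
         dSet C L x ∣ gcd (size C X) (eR C S y)
lemma3 C X Y S _ _ S∈XY L L-spec x y xX _ = gcd-greatest (d∣size x xX) (d∣eR x xX y)
  where open LeftStabiliser C X Y S S∈XY L L-spec
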